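{- Let $\Delta$ be a 3-colored simplicial complex and let $\Gamma\in\mathcal{F}(\Delta)$ with $g_1(\Gamma)=b_1(\Delta)$. If $r(\Gamma)=2$, then $f_{123}(\Gamma)\le v(\Delta,g_2(\Gamma))$.
   Context: A 3-colored simplicial complex is a finite simplicial complex with a coloring of its vertices by $[3]=\{1,2,3\}$ such that no face contains two vertices of the same color. $f_S(\Delta)$ is the number of faces with color set exactly $S\subseteq[3]$ (written $f_1,f_{12},f_{123}$, etc.; $f_{ij}=f_{\{i,j\}}$). Faces with color set $[3]$ are facets. Complexes are assumed to have $f_S>0$ for all $S$. Vertices of color $i$ are labeled $v^i_1,v^i_2,\dots$. Define $b_1(\Delta)=\lfloor\sqrt{f_{12}f_{13}/f_{23}}\rfloor$, $b_2(\Delta)=\lfloor\sqrt{f_{12}f_{23}/f_{13}}\rfloor$, $b_3(\Delta)=\lfloor\sqrt{f_{13}f_{23}/f_{12}}\rfloor$ (all $f$'s of $\Delta$), and for $t>0$, $v(\Delta,t)=b_1(\Delta)f_{23}(\Delta)+(f_{12}(\Delta)-b_1(\Delta)t)\big(f_{13}(\Delta)-b_1(\Delta)f_{23}(\Delta)/t\big)$. Construction: given $\Delta$, positive integers $g_1,g_2,g_3$ and distinct $p,q\in[3]$, build $\Gamma$ as follows. Start with vertices $v^i_1,\dots,v^i_{g_i}$ for each $i$, every two of distinct colors adjacent. If $f_p(\Delta)>g_p$, add $v^p_{g_p+1}$ and, for each color $c\ne p$, join it to the first $k_c$ present vertices of color $c$, with $k_c$ as large as possible so that the number of edges of color set $\{p,c\}$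 does not exceed $f_{pc}(\Delta)$. Then, if $f_q(\Delta)>g_q$, add $v^q_{g_q+1}$ and join it in the same way (the present vertices of color $p$ including $v^p_{g_p+1}$ if added). Faces: empty set, vertices, edges, all triples of pairwise adjacent vertices. Write $g_i(\Gamma),p(\Gamma),q(\Gamma)$ for the parameters and $r(\Gamma)=6-p(\Gamma)-q(\Gamma)$. $\mathcal{A}(\Delta)$ is the set of all complexes (with parameters) so constructed that are well defined and satisfy $f_S(\Gamma)\le f_S(\Delta)$ for all $S\ne[3]$. $m(\Delta)=\max\{f_{123}(\Gamma):\Gamma\in\mathcal{A}(\Delta)\}$; $\mathcal{B}(\Delta)=\{\Gamma\in\mathcal{A}(\Delta):f_{123}(\Gamma)=m(\Delta)\}$; $n(\Delta)=\max\{f_{12}(\Gamma)+f_{13}(\Gamma)+f_{23}(\Gamma):\Gamma\in\mathcal{B}(\Delta)\}$; $\mathcal{C}(\Delta)=\{\Gamma\in\mathcal{B}(\Delta):f_{12}(\Gamma)+f_{13}(\Gamma)+f_{23}(\Gamma)=n(\Delta)\}$; $\mathcal{D}(\Delta)=\{\Gamma\in\mathcal{C}(\Delta): f_{123}(\Gamma)<\min\{f_1(\Delta)f_{23}(\Delta),f_2(\Delta)f_{13}(\Delta),f_3(\Delta)f_{12}(\Delta)\}\}$. $\mathcal{F}(\Delta)$ is the set of $\Gamma$ such that $\Gamma\in\mathcal{A}(\Delta)$, $f_{12}(\Gamma)+f_{13}(\Gamma)+f_{23}(\Gamma)=f_{12}(\Delta)+f_{13}(\Delta)+f_{23}(\Delta)$,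 $\mathcal{D}(\Delta)\neq\emptyset$, and $g_i(\Gamma)=b_i(\Delta)$ for some $i\in[3]$. -}

module Defs where

open import Data.Bool using (Bool; true; false; _∧_; _∨_; not; if_then_else_)
open import Data.Bool.Properties using () renaming (_≟_ to _≟ᵇ_)
open import Data.Nat as ℕ using (ℕ; zero; suc; _+_; _*_; _∸_; _≤_; _<_; _≤ᵇ_; _<ᵇ_; _≡ᵇ_; NonZero)
open import Data.Fin using (Fin; zero; suc; toℕ)
open import Data.Fin.Properties using () renaming (_≟_ to _≟ᶠ_)
open import Data.Fin.Subset using (Subset; ⁅_⁆; _∪_; ⊤)
open import Data.Maybe using (Maybe; just; nothing; is-just)
open import Data.Vec using (Vec; []; _∷_; lookup)
open import Data.List using (List; []; _∷_; map; concatMap; upTo; length; filterᵇ; allFin)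
open import Data.Bool.ListAction using (and)
open import Data.Product using (_×_; _,_; Σ; ∃)
open import Data.Integer using (ℤ; +_)
import Data.Rational as ℚ
open import Relation.Nullary using (¬_; does)
open import Relation.Binary.PropositionalEquality using (_≡_; _≢_)

-- Colors.  Color i ∈ [3] = {1,2,3} is represented by the index
-- (i - 1) : Fin 3.  Color sets S ⊆ [3] are  Subset 3  (= Vec Bool 3).

c1 c2 c3 : Fin 3
c1 = zero
c2 = suc zero
c3 = suc (suc zero)

colNum : Fin 3 → ℕ
colNum i = suc (toℕ i)

-- Faces.  A face is given by, for each color i, either no vertex of
-- color i or the vertex v^i_{j+1} (stored as the index j : ℕ).
-- (So no face can contain two vertices of the same color.)

Face : Set
Face = Vec (Maybe ℕ) 3

_⊆F_ : Face → Face → Set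
τ ⊆F σ = ∀ i v → lookup τ i ≡ just v → lookup σ i ≡ just v

singleF : Fin 3 → ℕ → Face
singleF zero j = just j ∷ nothing ∷ nothing ∷ []
singleF (suc zero) j = nothing ∷ just j ∷ nothing ∷ []
singleF (suc (suc zero)) j = nothing ∷ nothing ∷ just j ∷ []

record Pre : Set where
  field
    nV     : Fin 3 → ℕ
    isFace : Face → Bool
open Pre public

options : ℕ → List (Maybe ℕ)
options n = nothing ∷ map just (upTo n)

allFaces : (Fin 3 → ℕ) → List Face
allFaces n =
  concatMap (λ a → concatMap (λ b → map (λ c → a ∷ b ∷ c ∷ []) (options (n c3)))
                              (options (n c2)))
            (options (n c1))

hasColors : Subset 3 → Face → Bool
hasColors S σ = and (map (λ i → does (is-just (lookup σ i) ≟ᵇ lookup S i)) (allFin 3))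

f : Subset 3 → Pre → ℕ
f S P = length (filterᵇ (λ σ → isFace P σ ∧ hasColors S σ) (allFaces (nV P)))

-- A 3-colored simplicial complex (with f_S > 0 for all S, the standing
-- assumption of the paper).
record Complex3 : Set where
  field
    pre        : Pre
    inRange    : ∀ σ → isFace pre σ ≡ true → ∀ i v → lookup σ i ≡ just v → v < nV pre i
    downClosed : ∀ σ τ → isFace pre σ ≡ true → τ ⊆F σ → isFace pre τ ≡ true
    vertices   : ∀ i v → v < nV pre i → isFace pre (singleF i v) ≡ true
    positive   : ∀ S → 0 < f S pre
open Complex3 public

pairS : Fin 3 → Fin 3 → Subset 3
pairS a b = ⁅ a ⁆ ∪ ⁅ b ⁆

fV : Fin 3 → Pre → ℕ
fV i P = f ⁅ i ⁆ P

fE : Fin 3 → Fin 3 → Pre → ℕ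
fE a b P = f (pairS a b) P

f123 : Pre → ℕ
f123 P = f ⊤ P

-- ⌊ √(a / d) ⌋  for d > 0 : the largest k ≤ a with k·k·d ≤ a
-- (any k with k·k·d ≤ a, d ≥ 1, satisfies k ≤ a).
floorSqrtDiv : ℕ → ℕ → ℕ
floorSqrtDiv a d = go a
  where
  go : ℕ → ℕ
  go zero = zero
  go (suc k) = if (suc k * suc k * d) ≤ᵇ a then suc k else go k

b₁ b₂ b₃ : Pre → ℕ
b₁ Δ = floorSqrtDiv (fE c1 c2 Δ * fE c1 c3 Δ) (fE c2 c3 Δ)
b₂ Δ = floorSqrtDiv (fE c1 c2 Δ * fE c2 c3 Δ) (fE c1 c3 Δ)
b₃ Δ = floorSqrtDiv (fE c1 c3 Δ * fE c2 c3 Δ) (fE c1 c2 Δ)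

bᵢ : Fin 3 → Pre → ℕ
bᵢ zero = b₁
bᵢ (suc zero) = b₂
bᵢ (suc (suc zero)) = b₃

ℕ→ℚ : ℕ → ℚ.ℚ
ℕ→ℚ n = (+ n) ℚ./ 1

v : Pre → (t : ℕ) → .{{NonZero t}} → ℚ.ℚ
v Δ t = ℕ→ℚ (b₁ Δ * fE c2 c3 Δ)
        ℚ.+ (ℕ→ℚ (fE c1 c2 Δ) ℚ.- ℕ→ℚ (b₁ Δ * t))
            ℚ.* (ℕ→ℚ (fE c1 c3 Δ) ℚ.- ((+ (b₁ Δ * fE c2 c3 Δ)) ℚ./ t))

-- The construction.  A 3-colored graph: vertex counts per color, and
-- adjacency adj a x b y  between v^a_{x+1} and v^b_{y+1} (a ≠ b).

record Graph : Set where
  field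
    n   : Fin 3 → ℕ
    adj : Fin 3 → ℕ → Fin 3 → ℕ → Bool
open Graph public

-- the clique complex: faces are the empty set, vertices, edges and all
-- triples of pairwise adjacent vertices
okPair : Graph → Fin 3 → Maybe ℕ → Fin 3 → Maybe ℕ → Bool
okPair G a (just x) b (just y) = adj G a x b y
okPair G a _ b _ = true

okVert : Graph → Fin 3 → Maybe ℕ → Bool
okVert G i nothing = true
okVert G i (just x) = x <ᵇ n G i

flag : Graph → Pre
flag G = record
  { nV = n G
  ; isFace = λ σ → okVert G c1 (lookup σ c1) ∧ okVert G c2 (lookup σ c2) ∧ okVert G c3 (lookup σ c3)
                   ∧ okPair G c1 (lookup σ c1) c2 (lookup σ c2)
                   ∧ okPair G c1 (lookup σ c1) c3 (lookup σ c3)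
                   ∧ okPair G c2 (lookup σ c2) c3 (lookup σ c3)
  }

record Params : Set where
  field
    g     : Fin 3 → ℕ
    g-pos : ∀ i → NonZero (g i)
    p q   : Fin 3
    p≢q   : p ≢ q
open Params public

r : Params → ℕ
r P = 6 ∸ colNum (p P) ∸ colNum (q P)

G₀ : Params → Graph
G₀ P = record { n = g P ; adj = λ _ _ _ _ → true }

_=ᶠ_ : Fin 3 → Fin 3 → Bool
a =ᶠ b = does (a ≟ᶠ b)

-- k_c : as large as possible (at most the number of present vertices
-- of color c) so that the number of {col,c}-edges does not exceed
-- f_{col,c}(Δ): the new vertex adds exactly k_c such edges.
kk : Pre → Graph → Fin 3 → Fin 3 → ℕ
kk Δ G col c = ℕ._⊓_ (n G c) (fE col c Δ ∸ fE col c (flag G))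

-- add the vertex v^col_{n col + 1} joined to the first k_c vertices of
-- each color c ≠ col
addV : Pre → Graph → Fin 3 → Graph
addV Δ G col = record
  { n = λ i → if i =ᶠ col then suc (n G i) else n G i
  ; adj = λ a x b y →
      if (a =ᶠ col) ∧ (x ≡ᵇ n G col) then y <ᵇ kk Δ G col b
      else if (b =ᶠ col) ∧ (y ≡ᵇ n G col) then x <ᵇ kk Δ G col a
      else adj G a x b y
  }

step : Pre → Params → Graph → Fin 3 → Graph
step Δ P G col = if g P col <ᵇ fV col Δ then addV Δ G col else G

G₁ : Pre → Params → Graph
G₁ Δ P = step Δ P (G₀ P) (p P)

Γ : Pre → Params → Graph
Γ Δ P = step Δ P (G₁ Δ P) (q P)

-- well defined: whenever a vertex of color col is added, for every
-- color c ≠ col some k_c is admissible, i.e. the current number of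
-- {col,c}-edges does not already exceed f_{col,c}(Δ).
StepOK : Pre → Params → Graph → Fin 3 → Set
StepOK Δ P G col = g P col < fV col Δ → ∀ c → c ≢ col → fE col c (flag G) ≤ fE col c Δ

WellDefined : Pre → Params → Set
WellDefined Δ P = StepOK Δ P (G₀ P) (p P) × StepOK Δ P (G₁ Δ P) (q P)

fΓ : Subset 3 → Pre → Params → ℕ
fΓ S Δ P = f S (flag (Γ Δ P))

edgeSum : Pre → ℕ
edgeSum X = fE c1 c2 X + fE c1 c3 X + fE c2 c3 X

InA : Complex3 → Params → Set
InA Δ P = WellDefined (pre Δ) P × (∀ S → S ≢ ⊤ → fΓ S (pre Δ) P ≤ f S (pre Δ))

InB : Complex3 → Params → Set
InB Δ P = InA Δ P × (∀ P' → InA Δ P' → f123 (flag (Γ (pre Δ) P')) ≤ f123 (flag (Γ (pre Δ) P)))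

InC : Complex3 → Params → Set
InC Δ P = InB Δ P × (∀ P' → InB Δ P' → edgeSum (flag (Γ (pre Δ) P')) ≤ edgeSum (flag (Γ (pre Δ) P)))

InD : Complex3 → Params → Set
InD Δ P = InC Δ P
  × f123 (flag (Γ (pre Δ) P)) < fV c1 (pre Δ) * fE c2 c3 (pre Δ)
  × f123 (flag (Γ (pre Δ) P)) < fV c2 (pre Δ) * fE c1 c3 (pre Δ)
  × f123 (flag (Γ (pre Δ) P)) < fV c3 (pre Δ) * fE c1 c2 (pre Δ)

InF : Complex3 → Params → Set
InF Δ P = InA Δ P
  × edgeSum (flag (Γ (pre Δ) P)) ≡ edgeSum (pre Δ)
  × (∃ λ P' → InD Δ P')
  × (∃ λ i → g P i ≡ bᵢ i (pre Δ))

-- Γ ∈ 𝓕(Δ) has at most f_{ij}(Δ) edges of each type and the same total number of edges as Δ,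
-- so its edge numbers are exactly those of Δ.  When r = 2 the construction adds to the complete
-- 3-partite graph on g₁, g₂, g₃ vertices at most one vertex of colour 1 and one of colour 3, in
-- either order.  Counting edges and triangles gives f₁₂ = g₁g₂ + a₂, f₁₃ = g₁g₃ + a₃ + m + d,
-- f₂₃ = g₂g₃ + k and f₁₂₃(Γ) ≤ g₁g₂g₃ + a₂a₃ + mk + da₂ with m ≤ g₁ and a₂, k ≤ g₂.  With b₁ = g₁
-- and t = g₂ we get f₁₂ − b₁t = a₂, and after multiplying by t the claim f₁₂₃(Γ) ≤ v(Δ,t) becomes
-- a polynomial inequality in these parameters.  Only membership in 𝒜(Δ), the edge count of 𝓕(Δ),
-- g₁ = b₁ and r = 2 are used.

module Submission where

open import Defs
open import Relation.Binary.PropositionalEquality using (_≡_)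
import Data.Rational as ℚ
open import Data.Bool using (Bool; true; false; _∧_)
open import Data.Bool.Properties using (∧-identityʳ; ∧-zeroʳ)
open import Data.Empty using (⊥-elim)
open import Data.Fin using (Fin; zero; suc)
open import Data.Fin.Properties using () renaming (_≟_ to _≟ᶠ_)
open import Data.Fin.Subset using (Subset; ⊤)
import Data.Integer as ℤ
import Data.Integer.Properties as ℤP
open import Data.List using (List; []; _∷_; _++_; map; concatMap; applyUpTo; length; filterᵇ)
open import Data.List.Properties using (filter-++; length-++)
open import Data.Maybe using (Maybe; just; nothing)
open import Data.Nat using (ℕ; zero; suc; NonZero; _+_; _*_; _∸_; _≤_; _<_; _<ᵇ_; _≡ᵇ_; _⊓_; z≤n; s≤s)
open import Data.Nat.Properties
open import Algebra.Properties.CommutativeSemigroup +-commutativeSemigroup using (interchange)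
open import Data.Nat.Tactic.RingSolver using (solve-∀)
open import Data.Product using (_×_; _,_; proj₁; proj₂)
open import Data.Rational using (ℚ; toℚᵘ)
import Data.Rational.Properties as ℚP
open import Data.Rational.Solver using (module +-*-Solver)
open import Data.Rational.Unnormalised as ℚᵘ using (ℚᵘ; mkℚᵘ; *≡*; *≤*)
import Data.Rational.Unnormalised.Properties as ℚᵘP
open import Data.Sum using (_⊎_; inj₁; inj₂)
open import Data.Vec using ([]; _∷_)
open import Function using (_∘_)
open import Relation.Binary.PropositionalEquality hiding (_≡_)
open import Relation.Nullary using (yes; no; T?)
open import Relation.Nullary.Decidable using (dec-true; dec-false)

-- Natural numbers in ℚ and the shape of v(Δ,t)

ℕ→ℚᵘ : ℕ → ℚᵘ
ℕ→ℚᵘ n = mkℚᵘ (ℤ.+ n) 0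

toℚᵘ-ℕ→ℚ : ∀ n → toℚᵘ (ℕ→ℚ n) ℚᵘ.≃ ℕ→ℚᵘ n
toℚᵘ-ℕ→ℚ n = ℚP.toℚᵘ-fromℚᵘ (ℕ→ℚᵘ n)

ℕ→ℚ-homo-+ : ∀ m n → ℕ→ℚ (m + n) ≡ ℕ→ℚ m ℚ.+ ℕ→ℚ n
ℕ→ℚ-homo-+ m n = ℚP.toℚᵘ-injective (begin
  toℚᵘ (ℕ→ℚ (m + n))               ≈⟨ toℚᵘ-ℕ→ℚ (m + n) ⟩
  ℕ→ℚᵘ (m + n)                     ≈⟨ *≡* numerators ⟩
  ℕ→ℚᵘ m ℚᵘ.+ ℕ→ℚᵘ n               ≈⟨ ℚᵘP.+-cong (toℚᵘ-ℕ→ℚ m) (toℚᵘ-ℕ→ℚ n) ⟨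
  toℚᵘ (ℕ→ℚ m) ℚᵘ.+ toℚᵘ (ℕ→ℚ n)   ≈⟨ ℚP.toℚᵘ-homo-+ (ℕ→ℚ m) (ℕ→ℚ n) ⟨
  toℚᵘ (ℕ→ℚ m ℚ.+ ℕ→ℚ n)           ∎)
  where
  open ℚᵘP.≃-Reasoning
  numerators : ℤ.+ (m + n) ℤ.* ℤ.1ℤ ≡ (ℤ.+ m ℤ.* ℤ.1ℤ ℤ.+ ℤ.+ n ℤ.* ℤ.1ℤ) ℤ.* ℤ.1ℤ
  numerators rewrite ℤP.*-identityʳ (ℤ.+ m) | ℤP.*-identityʳ (ℤ.+ n) = cong (ℤ._* ℤ.1ℤ) (ℤP.pos-+ m n)

ℕ→ℚ-homo-* : ∀ m n → ℕ→ℚ (m * n) ≡ ℕ→ℚ m ℚ.* ℕ→ℚ n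
ℕ→ℚ-homo-* m n = ℚP.toℚᵘ-injective (begin
  toℚᵘ (ℕ→ℚ (m * n))               ≈⟨ toℚᵘ-ℕ→ℚ (m * n) ⟩
  ℕ→ℚᵘ (m * n)                     ≈⟨ *≡* (cong (ℤ._* ℤ.1ℤ) (ℤP.pos-* m n)) ⟩
  ℕ→ℚᵘ m ℚᵘ.* ℕ→ℚᵘ n               ≈⟨ ℚᵘP.*-cong (toℚᵘ-ℕ→ℚ m) (toℚᵘ-ℕ→ℚ n) ⟨
  toℚᵘ (ℕ→ℚ m) ℚᵘ.* toℚᵘ (ℕ→ℚ n)   ≈⟨ ℚP.toℚᵘ-homo-* (ℕ→ℚ m) (ℕ→ℚ n) ⟨
  toℚᵘ (ℕ→ℚ m ℚ.* ℕ→ℚ n)           ∎)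
  where open ℚᵘP.≃-Reasoning

ℕ→ℚ-*-/ : ∀ t n .{{_ : NonZero t}} → ℕ→ℚ t ℚ.* (ℤ.+ n ℚ./ t) ≡ ℕ→ℚ n
ℕ→ℚ-*-/ (suc t) n = ℚP.toℚᵘ-injective (begin
  toℚᵘ (ℕ→ℚ (suc t) ℚ.* (ℤ.+ n ℚ./ suc t))
    ≈⟨ ℚP.toℚᵘ-homo-* (ℕ→ℚ (suc t)) (ℤ.+ n ℚ./ suc t) ⟩
  toℚᵘ (ℕ→ℚ (suc t)) ℚᵘ.* toℚᵘ (ℤ.+ n ℚ./ suc t)
    ≈⟨ ℚᵘP.*-cong (toℚᵘ-ℕ→ℚ (suc t)) (ℚP.toℚᵘ-fromℚᵘ (mkℚᵘ (ℤ.+ n) t)) ⟩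
  ℕ→ℚᵘ (suc t) ℚᵘ.* mkℚᵘ (ℤ.+ n) t
    ≈⟨ *≡* numerators ⟩
  ℕ→ℚᵘ n
    ≈⟨ toℚᵘ-ℕ→ℚ n ⟨
  toℚᵘ (ℕ→ℚ n) ∎)
  where
  open ℚᵘP.≃-Reasoning
  numerators : (ℤ.+ suc t ℤ.* ℤ.+ n) ℤ.* ℤ.1ℤ ≡ ℤ.+ n ℤ.* ℤ.+ (1 * suc t)
  numerators = trans (ℤP.*-identityʳ _)
    (trans (ℤP.*-comm (ℤ.+ suc t) (ℤ.+ n)) (cong (λ d → ℤ.+ n ℤ.* ℤ.+ d) (sym (*-identityˡ (suc t)))))

ℕ→ℚ-mono-≤ : ∀ {m n} → m ≤ n → ℕ→ℚ m ℚ.≤ ℕ→ℚ n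
ℕ→ℚ-mono-≤ {m} {n} m≤n = ℚP.toℚᵘ-cancel-≤
  (ℚᵘP.≤-respˡ-≃ (ℚᵘP.≃-sym (toℚᵘ-ℕ→ℚ m)) (ℚᵘP.≤-respʳ-≃ (ℚᵘP.≃-sym (toℚᵘ-ℕ→ℚ n))
    (*≤* (ℤP.*-monoʳ-≤-nonNeg ℤ.1ℤ (ℤ.+≤+ m≤n)))))

ℕ→ℚ-positive : ∀ t .{{_ : NonZero t}} → ℚ.Positive (ℕ→ℚ t)
ℕ→ℚ-positive (suc t) = ℚ.positive {ℕ→ℚ (suc t)}
  (ℚP.<-≤-trans {ℕ→ℚ 0} {ℕ→ℚ 1} (ℚ.*<* (ℤ.+<+ (s≤s z≤n))) (ℕ→ℚ-mono-≤ {1} {suc t} (s≤s z≤n)))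

vForm : (A a D t : ℕ) .{{_ : NonZero t}} → ℚ
vForm A a D t = ℕ→ℚ A ℚ.+ ℕ→ℚ a ℚ.* (ℕ→ℚ D ℚ.- ℤ.+ A ℚ./ t)

v≡vForm : ∀ Δ t a .{{_ : NonZero t}} → fE c1 c2 Δ ≡ b₁ Δ * t + a →
          v Δ t ≡ vForm (b₁ Δ * fE c2 c3 Δ) a (fE c1 c3 Δ) t
v≡vForm Δ t a f₁₂≡ = cong (λ y → ℕ→ℚ A ℚ.+ y ℚ.* (ℕ→ℚ (fE c1 c3 Δ) ℚ.- ℤ.+ A ℚ./ t)) (begin
  ℕ→ℚ (fE c1 c2 Δ) ℚ.- ℕ→ℚ bt          ≡⟨ cong (λ e → ℕ→ℚ e ℚ.- ℕ→ℚ bt) f₁₂≡ ⟩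
  ℕ→ℚ (bt + a) ℚ.- ℕ→ℚ bt              ≡⟨ cong (ℚ._- ℕ→ℚ bt) (ℕ→ℚ-homo-+ bt a) ⟩
  ℕ→ℚ bt ℚ.+ ℕ→ℚ a ℚ.- ℕ→ℚ bt          ≡⟨ ℚ-solve 2 (λ x y → x :+ y :- x := y) refl (ℕ→ℚ bt) (ℕ→ℚ a) ⟩
  ℕ→ℚ a                                ∎)
  where
  open ≡-Reasoning
  A bt : ℕ
  A = b₁ Δ * fE c2 c3 Δ
  bt = b₁ Δ * t
  open +-*-Solver using (_:+_; _:-_; _:=_) renaming (solve to ℚ-solve)

≤-vForm : ∀ F A a D t .{{_ : NonZero t}} → t * F + a * A ≤ t * A + a * (t * D) →
          ℕ→ℚ F ℚ.≤ vForm A a D t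
≤-vForm F A a D t h = ℚP.*-cancelˡ-≤-pos ⌜ t ⌝ {{ℕ→ℚ-positive t}} (begin
  ⌜ t ⌝ ℚ.* ⌜ F ⌝
    ≡⟨ ℚ-solve 2 (λ x y → x := x :+ y :- y) refl (⌜ t ⌝ ℚ.* ⌜ F ⌝) aA ⟩
  ⌜ t ⌝ ℚ.* ⌜ F ⌝ ℚ.+ aA ℚ.- aA
    ≡⟨ cong (ℚ._- aA) (trans (ℕ→ℚ-homo-+ (t * F) (a * A))
         (cong₂ ℚ._+_ (ℕ→ℚ-homo-* t F) (ℕ→ℚ-homo-* a A))) ⟨
  ⌜ t * F + a * A ⌝ ℚ.- aA
    ≤⟨ ℚP.+-monoˡ-≤ (ℚ.- aA) (ℕ→ℚ-mono-≤ h) ⟩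
  ⌜ t * A + a * (t * D) ⌝ ℚ.- aA
    ≡⟨ cong (ℚ._- aA) (trans (ℕ→ℚ-homo-+ (t * A) (a * (t * D)))
         (cong₂ ℚ._+_ (ℕ→ℚ-homo-* t A)
           (trans (ℕ→ℚ-homo-* a (t * D)) (cong (⌜ a ⌝ ℚ.*_) (ℕ→ℚ-homo-* t D))))) ⟩
  ⌜ t ⌝ ℚ.* ⌜ A ⌝ ℚ.+ ⌜ a ⌝ ℚ.* (⌜ t ⌝ ℚ.* ⌜ D ⌝) ℚ.- ⌜ a ⌝ ℚ.* ⌜ A ⌝
    ≡⟨ cong (λ y → ⌜ t ⌝ ℚ.* ⌜ A ⌝ ℚ.+ ⌜ a ⌝ ℚ.* (⌜ t ⌝ ℚ.* ⌜ D ⌝) ℚ.- ⌜ a ⌝ ℚ.* y) (ℕ→ℚ-*-/ t A) ⟨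
  ⌜ t ⌝ ℚ.* ⌜ A ⌝ ℚ.+ ⌜ a ⌝ ℚ.* (⌜ t ⌝ ℚ.* ⌜ D ⌝) ℚ.- ⌜ a ⌝ ℚ.* (⌜ t ⌝ ℚ.* A/t)
    ≡⟨ ℚ-solve 5 (λ t A a D X → t :* A :+ a :* (t :* D) :- a :* (t :* X) := t :* (A :+ a :* (D :- X)))
         refl ⌜ t ⌝ ⌜ A ⌝ ⌜ a ⌝ ⌜ D ⌝ A/t ⟩
  ⌜ t ⌝ ℚ.* vForm A a D t ∎)
  where
  open ℚP.≤-Reasoning
  open +-*-Solver using (_:+_; _:-_; _:*_; _:=_) renaming (solve to ℚ-solve)
  ⌜_⌝ : ℕ → ℚ
  ⌜_⌝ = ℕ→ℚ
  A/t aA : ℚ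
  A/t = ℤ.+ A ℚ./ t
  aA = ⌜ a ⌝ ℚ.* ⌜ A ⌝

-- Finite sums and counting

𝟙 : Bool → ℕ
𝟙 true = 1
𝟙 false = 0

𝟙-∧ : ∀ a b → 𝟙 (a ∧ b) ≡ 𝟙 a * 𝟙 b
𝟙-∧ true b = sym (+-identityʳ (𝟙 b))
𝟙-∧ false b = refl

𝟙-∧-≤ʳ : ∀ a b → 𝟙 (a ∧ b) ≤ 𝟙 b
𝟙-∧-≤ʳ true b = ≤-refl
𝟙-∧-≤ʳ false b = z≤n

𝟙≤1 : ∀ a → 𝟙 a ≤ 1
𝟙≤1 true = ≤-refl
𝟙≤1 false = z≤n

𝟙-∧-false : ∀ a → 𝟙 (a ∧ false) ≡ 0
𝟙-∧-false a = cong 𝟙 (∧-zeroʳ a)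

<ᵇ-true : ∀ {x n} → x < n → (x <ᵇ n) ≡ true
<ᵇ-true {x} {n} = dec-true (x <? n)

≡ᵇ-false : ∀ {x n} → x ≢ n → (x ≡ᵇ n) ≡ false
≡ᵇ-false {x} {n} = dec-false (x ≟ n)

≡ᵇ-refl : ∀ n → (n ≡ᵇ n) ≡ true
≡ᵇ-refl n = dec-true (n ≟ n) refl

∑ : ℕ → (ℕ → ℕ) → ℕ
∑ zero f = 0
∑ (suc n) f = ∑ n f + f n

∑-cong : ∀ n {f h} → (∀ i → i < n → f i ≡ h i) → ∑ n f ≡ ∑ n h
∑-cong zero e = refl
∑-cong (suc n) e = cong₂ _+_ (∑-cong n (λ i i<n → e i (m≤n⇒m≤1+n i<n))) (e n ≤-refl)

∑-mono-≤ : ∀ n {f h} → (∀ i → f i ≤ h i) → ∑ n f ≤ ∑ n h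
∑-mono-≤ zero le = z≤n
∑-mono-≤ (suc n) le = +-mono-≤ (∑-mono-≤ n le) (le n)

∑-zero : ∀ n {f} → (∀ i → f i ≡ 0) → ∑ n f ≡ 0
∑-zero zero e = refl
∑-zero (suc n) e = cong₂ _+_ (∑-zero n e) (e n)

∑-suc : ∀ n f → ∑ (suc n) f ≡ f 0 + ∑ n (f ∘ suc)
∑-suc zero f = +-comm 0 (f 0)
∑-suc (suc n) f = trans (cong (_+ f (suc n)) (∑-suc n f)) (+-assoc (f 0) _ _)

∑-+ : ∀ n f h → ∑ n (λ i → f i + h i) ≡ ∑ n f + ∑ n h
∑-+ zero f h = refl
∑-+ (suc n) f h = trans (cong (_+ (f n + h n)) (∑-+ n f h)) (interchange (∑ n f) (∑ n h) (f n) (h n))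

∑-*ˡ : ∀ n c f → ∑ n (λ i → c * f i) ≡ c * ∑ n f
∑-*ˡ zero c f = sym (*-zeroʳ c)
∑-*ˡ (suc n) c f = trans (cong (_+ c * f n) (∑-*ˡ n c f)) (sym (*-distribˡ-+ c (∑ n f) (f n)))

∑-*ʳ : ∀ n c f → ∑ n (λ i → f i * c) ≡ ∑ n f * c
∑-*ʳ zero c f = refl
∑-*ʳ (suc n) c f = trans (cong (_+ f n * c) (∑-*ʳ n c f)) (sym (*-distribʳ-+ c (∑ n f) (f n)))

∑-const : ∀ n c → ∑ n (λ _ → c) ≡ n * c
∑-const zero c = refl
∑-const (suc n) c = trans (cong (_+ c) (∑-const n c)) (+-comm (n * c) c)

∑-<ᵇ : ∀ n k → ∑ n (λ i → 𝟙 (i <ᵇ k)) ≡ n ⊓ k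
∑-<ᵇ zero k = refl
∑-<ᵇ (suc n) zero = trans (∑-suc n _) (∑-zero n {λ i → 𝟙 (suc i <ᵇ 0)} (λ _ → refl))
∑-<ᵇ (suc n) (suc k) = trans (∑-suc n _) (cong suc (∑-<ᵇ n k))

∑-<ᵇ-≤ : ∀ {n k} → k ≤ n → ∑ n (λ i → 𝟙 (i <ᵇ k)) ≡ k
∑-<ᵇ-≤ {n} {k} k≤n = trans (∑-<ᵇ n k) (m≥n⇒m⊓n≡n k≤n)

∑∑-<ᵇ : ∀ n m K L → ∑ n (λ x → ∑ m (λ y → 𝟙 ((x <ᵇ K) ∧ (y <ᵇ L)))) ≡ (n ⊓ K) * (m ⊓ L)
∑∑-<ᵇ n m K L = begin
  ∑ n (λ x → ∑ m (λ y → 𝟙 ((x <ᵇ K) ∧ (y <ᵇ L))))       ≡⟨ ∑-cong n (λ x _ → ∑-cong m (λ y _ → 𝟙-∧ (x <ᵇ K) (y <ᵇ L))) ⟩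
  ∑ n (λ x → ∑ m (λ y → 𝟙 (x <ᵇ K) * 𝟙 (y <ᵇ L)))       ≡⟨ ∑-cong n (λ x _ → ∑-*ˡ m (𝟙 (x <ᵇ K)) _) ⟩
  ∑ n (λ x → 𝟙 (x <ᵇ K) * ∑ m (λ y → 𝟙 (y <ᵇ L)))       ≡⟨ ∑-*ʳ n _ (λ x → 𝟙 (x <ᵇ K)) ⟩
  ∑ n (λ x → 𝟙 (x <ᵇ K)) * ∑ m (λ y → 𝟙 (y <ᵇ L))       ≡⟨ cong₂ _*_ (∑-<ᵇ n K) (∑-<ᵇ m L) ⟩
  (n ⊓ K) * (m ⊓ L)                                     ∎
  where open ≡-Reasoning

⊓-+-𝟙<ᵇ : ∀ n {k} → k ≤ suc n → k ≡ n ⊓ k + 𝟙 (n <ᵇ k)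
⊓-+-𝟙<ᵇ n {k} k≤1+n = trans (sym (∑-<ᵇ-≤ k≤1+n)) (cong (_+ 𝟙 (n <ᵇ k)) (∑-<ᵇ n k))

count : {A : Set} → (A → Bool) → List A → ℕ
count P xs = length (filterᵇ P xs)

count-∷ : ∀ {A : Set} (P : A → Bool) x xs → count P (x ∷ xs) ≡ 𝟙 (P x) + count P xs
count-∷ P x xs with P x
... | true = refl
... | false = refl

count-++ : ∀ {A : Set} (P : A → Bool) xs ys → count P (xs ++ ys) ≡ count P xs + count P ys
count-++ P xs ys = trans (cong length (filter-++ (T? ∘ P) xs ys)) (length-++ (filterᵇ P xs))

∑ᵒ : ℕ → (Maybe ℕ → ℕ) → ℕ
∑ᵒ n k = k nothing + ∑ n (k ∘ just)

∑ᵒ-cong : ∀ n {k h} → (∀ o → k o ≡ h o) → ∑ᵒ n k ≡ ∑ᵒ n h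
∑ᵒ-cong n e = cong₂ _+_ (e nothing) (∑-cong n (λ i _ → e (just i)))

∑ᵒ-just : ∀ n k → k nothing ≡ 0 → ∑ᵒ n k ≡ ∑ n (k ∘ just)
∑ᵒ-just n k e = cong (_+ ∑ n (k ∘ just)) e

∑ᵒ-nothing : ∀ n k → (∀ i → k (just i) ≡ 0) → ∑ᵒ n k ≡ k nothing
∑ᵒ-nothing n k e = trans (cong (k nothing +_) (∑-zero n e)) (+-identityʳ (k nothing))

∑ᵒ-zero : ∀ n k → (∀ o → k o ≡ 0) → ∑ᵒ n k ≡ 0
∑ᵒ-zero n k e = cong₂ _+_ (e nothing) (∑-zero n (λ i → e (just i)))

module _ {A : Set} (P : A → Bool) where

  count-concatMap-upTo : ∀ (h : Maybe ℕ → List A) f n →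
    count P (concatMap h (map just (applyUpTo f n))) ≡ ∑ n (λ i → count P (h (just (f i))))
  count-concatMap-upTo h f zero = refl
  count-concatMap-upTo h f (suc n) = begin
    count P (h (just (f 0)) ++ concatMap h (map just (applyUpTo (f ∘ suc) n)))
      ≡⟨ count-++ P (h (just (f 0))) _ ⟩
    count P (h (just (f 0))) + count P (concatMap h (map just (applyUpTo (f ∘ suc) n)))
      ≡⟨ cong (count P (h (just (f 0))) +_) (count-concatMap-upTo h (f ∘ suc) n) ⟩
    count P (h (just (f 0))) + ∑ n (λ i → count P (h (just (f (suc i)))))
      ≡⟨ ∑-suc n (λ i → count P (h (just (f i)))) ⟨
    ∑ (suc n) (λ i → count P (h (just (f i)))) ∎
    where open ≡-Reasoning

  count-map-upTo : ∀ (h : Maybe ℕ → A) f n →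
    count P (map h (map just (applyUpTo f n))) ≡ ∑ n (λ i → 𝟙 (P (h (just (f i)))))
  count-map-upTo h f zero = refl
  count-map-upTo h f (suc n) =
    trans (count-∷ P (h (just (f 0))) _)
      (trans (cong (𝟙 (P (h (just (f 0)))) +_) (count-map-upTo h (f ∘ suc) n))
        (sym (∑-suc n (λ i → 𝟙 (P (h (just (f i))))))))

  count-concatMap-options : ∀ (h : Maybe ℕ → List A) n →
    count P (concatMap h (options n)) ≡ ∑ᵒ n (count P ∘ h)
  count-concatMap-options h n =
    trans (count-++ P (h nothing) _) (cong (count P (h nothing) +_) (count-concatMap-upTo h (λ i → i) n))

  count-map-options : ∀ (h : Maybe ℕ → A) n → count P (map h (options n)) ≡ ∑ᵒ n (𝟙 ∘ P ∘ h)
  count-map-options h n =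
    trans (count-∷ P (h nothing) _) (cong (𝟙 (P (h nothing)) +_) (count-map-upTo h (λ i → i) n))

count-allFaces : ∀ P N → count P (allFaces N) ≡
  ∑ᵒ (N c1) (λ a → ∑ᵒ (N c2) (λ b → ∑ᵒ (N c3) (λ c → 𝟙 (P (a ∷ b ∷ c ∷ [])))))
count-allFaces P N =
  trans (count-concatMap-options P outer (N c1)) (∑ᵒ-cong (N c1) λ a →
    trans (count-concatMap-options P (inner a) (N c2)) (∑ᵒ-cong (N c2) λ b →
      count-map-options P (λ c → a ∷ b ∷ c ∷ []) (N c3)))
  where
  inner : Maybe ℕ → Maybe ℕ → List Face
  inner a b = map (λ c → a ∷ b ∷ c ∷ []) (options (N c3))
  outer : Maybe ℕ → List Face
  outer a = concatMap (inner a) (options (N c2))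

-- Face numbers of clique complexes

edges : Graph → Fin 3 → Fin 3 → ℕ
edges G a b = ∑ (n G a) (λ x → ∑ (n G b) (λ y → 𝟙 (adj G a x b y)))

triangles : Graph → ℕ
triangles G = ∑ (n G c1) λ x → ∑ (n G c2) λ y → ∑ (n G c3) λ z →
  𝟙 (adj G c1 x c2 y ∧ adj G c1 x c3 z ∧ adj G c2 y c3 z)

edgesWithin : Graph → ℕ → ℕ → ℕ
edgesWithin G K₁ K₂ = ∑ (n G c1) λ x → ∑ (n G c2) λ y → 𝟙 (adj G c1 x c2 y ∧ (x <ᵇ K₁) ∧ (y <ᵇ K₂))

edgesWithin-≤ : ∀ G K₁ K₂ → edgesWithin G K₁ K₂ ≤ (n G c1 ⊓ K₁) * (n G c2 ⊓ K₂)
edgesWithin-≤ G K₁ K₂ = begin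
  edgesWithin G K₁ K₂
    ≤⟨ ∑-mono-≤ (n G c1) (λ x → ∑-mono-≤ (n G c2) λ y → 𝟙-∧-≤ʳ (adj G c1 x c2 y) ((x <ᵇ K₁) ∧ (y <ᵇ K₂))) ⟩
  ∑ (n G c1) (λ x → ∑ (n G c2) λ y → 𝟙 ((x <ᵇ K₁) ∧ (y <ᵇ K₂)))
    ≡⟨ ∑∑-<ᵇ (n G c1) (n G c2) K₁ K₂ ⟩
  (n G c1 ⊓ K₁) * (n G c2 ⊓ K₂) ∎
  where open ≤-Reasoning

module _ (G : Graph) where

  private
    n₁ n₂ n₃ : ℕ
    n₁ = n G c1
    n₂ = n G c2
    n₃ = n G c3

    faceOf : Subset 3 → Face → Bool
    faceOf S σ = isFace (flag G) σ ∧ hasColors S σ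

    cell : Subset 3 → Maybe ℕ → Maybe ℕ → Maybe ℕ → ℕ
    cell S a b c = 𝟙 (faceOf S (a ∷ b ∷ c ∷ []))

    row : Subset 3 → Maybe ℕ → Maybe ℕ → ℕ
    row S a b = ∑ᵒ n₃ (cell S a b)

    plane : Subset 3 → Maybe ℕ → ℕ
    plane S a = ∑ᵒ n₂ (row S a)

    cell-wrong : ∀ S a b c → hasColors S (a ∷ b ∷ c ∷ []) ≡ false → cell S a b c ≡ 0
    cell-wrong S a b c h rewrite h = 𝟙-∧-false _

    plane-wrong : ∀ S → (∀ b c → hasColors S (nothing ∷ b ∷ c ∷ []) ≡ false) → plane S nothing ≡ 0
    plane-wrong S h =
      ∑ᵒ-zero n₂ (row S nothing) λ b → ∑ᵒ-zero n₃ (cell S nothing b) λ c → cell-wrong S nothing b c (h b c)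

  f123-flag : f123 (flag G) ≡ triangles G
  f123-flag =
    trans (count-allFaces (faceOf ⊤) (n G)) (trans (∑ᵒ-just n₁ (plane ⊤) (plane-wrong ⊤ λ _ _ → refl))
      (∑-cong n₁ λ x x<n₁ →
        trans (∑ᵒ-just n₂ (row ⊤ (just x))
                (∑ᵒ-zero n₃ (cell ⊤ (just x) nothing) λ c → cell-wrong ⊤ (just x) nothing c refl))
          (∑-cong n₂ λ y y<n₂ →
            trans (∑ᵒ-just n₃ (cell ⊤ (just x) (just y)) (cell-wrong ⊤ (just x) (just y) nothing refl))
              (∑-cong n₃ λ z z<n₃ → triangle-cell x<n₁ y<n₂ z<n₃))))
    where
    triangle-cell : ∀ {x y z} → x < n₁ → y < n₂ → z < n₃ →
      cell ⊤ (just x) (just y) (just z) ≡ 𝟙 (adj G c1 x c2 y ∧ adj G c1 x c3 z ∧ adj G c2 y c3 z)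
    triangle-cell x<n₁ y<n₂ z<n₃ rewrite <ᵇ-true x<n₁ | <ᵇ-true y<n₂ | <ᵇ-true z<n₃ = cong 𝟙 (∧-identityʳ _)

  f12-flag : fE c1 c2 (flag G) ≡ edges G c1 c2
  f12-flag =
    trans (count-allFaces (faceOf S) (n G)) (trans (∑ᵒ-just n₁ (plane S) (plane-wrong S λ _ _ → refl))
      (∑-cong n₁ λ x x<n₁ →
        trans (∑ᵒ-just n₂ (row S (just x))
                (∑ᵒ-zero n₃ (cell S (just x) nothing) λ c → cell-wrong S (just x) nothing c refl))
          (∑-cong n₂ λ y y<n₂ →
            trans (∑ᵒ-nothing n₃ (cell S (just x) (just y)) λ z → cell-wrong S (just x) (just y) (just z) refl)
              (edge-cell x<n₁ y<n₂))))
    where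
    S : Subset 3
    S = pairS c1 c2
    edge-cell : ∀ {x y} → x < n₁ → y < n₂ → cell S (just x) (just y) nothing ≡ 𝟙 (adj G c1 x c2 y)
    edge-cell x<n₁ y<n₂ rewrite <ᵇ-true x<n₁ | <ᵇ-true y<n₂ = cong 𝟙 (trans (∧-identityʳ _) (∧-identityʳ _))

  f13-flag : fE c1 c3 (flag G) ≡ edges G c1 c3
  f13-flag =
    trans (count-allFaces (faceOf S) (n G)) (trans (∑ᵒ-just n₁ (plane S) (plane-wrong S λ _ _ → refl))
      (∑-cong n₁ λ x x<n₁ →
        trans (∑ᵒ-nothing n₂ (row S (just x)) λ y →
                 ∑ᵒ-zero n₃ (cell S (just x) (just y)) λ c → cell-wrong S (just x) (just y) c refl)
          (trans (∑ᵒ-just n₃ (cell S (just x) nothing) (cell-wrong S (just x) nothing nothing refl))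
            (∑-cong n₃ λ z z<n₃ → edge-cell x<n₁ z<n₃))))
    where
    S : Subset 3
    S = pairS c1 c3
    edge-cell : ∀ {x z} → x < n₁ → z < n₃ → cell S (just x) nothing (just z) ≡ 𝟙 (adj G c1 x c3 z)
    edge-cell x<n₁ z<n₃ rewrite <ᵇ-true x<n₁ | <ᵇ-true z<n₃ = cong 𝟙 (trans (∧-identityʳ _) (∧-identityʳ _))

  f23-flag : fE c2 c3 (flag G) ≡ edges G c2 c3
  f23-flag =
    trans (count-allFaces (faceOf S) (n G))
      (trans (∑ᵒ-nothing n₁ (plane S) λ x →
                ∑ᵒ-zero n₂ (row S (just x)) λ b → ∑ᵒ-zero n₃ (cell S (just x) b) λ c → cell-wrong S (just x) b c refl)
        (trans (∑ᵒ-just n₂ (row S nothing)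
                 (∑ᵒ-zero n₃ (cell S nothing nothing) λ c → cell-wrong S nothing nothing c refl))
          (∑-cong n₂ λ y y<n₂ →
            trans (∑ᵒ-just n₃ (cell S nothing (just y)) (cell-wrong S nothing (just y) nothing refl))
              (∑-cong n₃ λ z z<n₃ → edge-cell y<n₂ z<n₃))))
    where
    S : Subset 3
    S = pairS c2 c3
    edge-cell : ∀ {y z} → y < n₂ → z < n₃ → cell S nothing (just y) (just z) ≡ 𝟙 (adj G c2 y c3 z)
    edge-cell y<n₂ z<n₃ rewrite <ᵇ-true y<n₂ | <ᵇ-true z<n₃ = cong 𝟙 (∧-identityʳ _)

-- Adding a vertex

kk≤n : ∀ Δ G col c → kk Δ G col c ≤ n G c
kk≤n Δ G col c = m⊓n≤m (n G c) _

module _ (Δ : Pre) (G : Graph) where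

  private
    G′ : Fin 3 → Graph
    G′ = addV Δ G

  n-addV-self : ∀ col → n (G′ col) col ≡ suc (n G col)
  n-addV-self col rewrite dec-true (col ≟ᶠ col) refl = refl

  n-addV-other : ∀ {c col} → c ≢ col → n (G′ col) c ≡ n G c
  n-addV-other {c} {col} c≢col rewrite dec-false (c ≟ᶠ col) c≢col = refl

  private
    isNew-old : ∀ {a x} col → x < n G a → ((a =ᶠ col) ∧ (x ≡ᵇ n G col)) ≡ false
    isNew-old {a} col x<n with a ≟ᶠ col
    ... | yes refl = ≡ᵇ-false (<⇒≢ x<n)
    ... | no _ = refl

  adj-addV-old : ∀ {a x b y} col → x < n G a → y < n G b → adj (G′ col) a x b y ≡ adj G a x b y
  adj-addV-old col x<n y<n rewrite isNew-old col x<n | isNew-old col y<n = refl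

  adj-addV-newˡ : ∀ col {b y} → adj (G′ col) col (n G col) b y ≡ (y <ᵇ kk Δ G col b)
  adj-addV-newˡ col rewrite dec-true (col ≟ᶠ col) refl | ≡ᵇ-refl (n G col) = refl

  adj-addV-newʳ : ∀ col {a x} → a ≢ col → adj (G′ col) a x col (n G col) ≡ (x <ᵇ kk Δ G col a)
  adj-addV-newʳ col {a} a≢col
    rewrite dec-false (a ≟ᶠ col) a≢col | dec-true (col ≟ᶠ col) refl | ≡ᵇ-refl (n G col) = refl

  edges-addV-apart : ∀ col a b → a ≢ col → b ≢ col → edges (G′ col) a b ≡ edges G a b
  edges-addV-apart col a b a≢col b≢col = begin
    edges (G′ col) a b
      ≡⟨ cong₂ (λ N M → ∑ N λ x → ∑ M λ y → 𝟙 (adj (G′ col) a x b y)) (n-addV-other a≢col) (n-addV-other b≢col) ⟩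
    ∑ (n G a) (λ x → ∑ (n G b) λ y → 𝟙 (adj (G′ col) a x b y))
      ≡⟨ ∑-cong (n G a) (λ x x<n → ∑-cong (n G b) λ y y<n → cong 𝟙 (adj-addV-old col x<n y<n)) ⟩
    edges G a b ∎
    where open ≡-Reasoning

  edges-addV-from : ∀ col b → b ≢ col → edges (G′ col) col b ≡ edges G col b + kk Δ G col b
  edges-addV-from col b b≢col = begin
    edges (G′ col) col b
      ≡⟨ cong₂ (λ N M → ∑ N λ x → ∑ M λ y → 𝟙 (adj (G′ col) col x b y)) (n-addV-self col) (n-addV-other b≢col) ⟩
    ∑ (n G col) (λ x → ∑ (n G b) λ y → 𝟙 (adj (G′ col) col x b y))
      + ∑ (n G b) (λ y → 𝟙 (adj (G′ col) col (n G col) b y))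
      ≡⟨ cong₂ _+_ (∑-cong (n G col) λ x x<n → ∑-cong (n G b) λ y y<n → cong 𝟙 (adj-addV-old col x<n y<n))
                   (∑-cong (n G b) λ y _ → cong 𝟙 (adj-addV-newˡ col)) ⟩
    edges G col b + ∑ (n G b) (λ y → 𝟙 (y <ᵇ kk Δ G col b))
      ≡⟨ cong (edges G col b +_) (∑-<ᵇ-≤ (kk≤n Δ G col b)) ⟩
    edges G col b + kk Δ G col b ∎
    where open ≡-Reasoning

  edges-addV-to : ∀ col a → a ≢ col → edges (G′ col) a col ≡ edges G a col + kk Δ G col a
  edges-addV-to col a a≢col = begin
    edges (G′ col) a col
      ≡⟨ cong₂ (λ N M → ∑ N λ x → ∑ M λ y → 𝟙 (adj (G′ col) a x col y)) (n-addV-other a≢col) (n-addV-self col) ⟩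
    ∑ (n G a) (λ x → ∑ (n G col) (λ y → 𝟙 (adj (G′ col) a x col y)) + 𝟙 (adj (G′ col) a x col (n G col)))
      ≡⟨ ∑-cong (n G a) (λ x x<n → cong₂ _+_ (∑-cong (n G col) λ y y<n → cong 𝟙 (adj-addV-old col x<n y<n))
                                              (cong 𝟙 (adj-addV-newʳ col a≢col))) ⟩
    ∑ (n G a) (λ x → ∑ (n G col) (λ y → 𝟙 (adj G a x col y)) + 𝟙 (x <ᵇ kk Δ G col a))
      ≡⟨ ∑-+ (n G a) _ _ ⟩
    edges G a col + ∑ (n G a) (λ x → 𝟙 (x <ᵇ kk Δ G col a))
      ≡⟨ cong (edges G a col +_) (∑-<ᵇ-≤ (kk≤n Δ G col a)) ⟩
    edges G a col + kk Δ G col a ∎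
    where open ≡-Reasoning

  triangles-addV₁ : triangles (G′ c1) ≤ triangles G + kk Δ G c1 c2 * kk Δ G c1 c3
  triangles-addV₁ = +-mono-≤ (≤-reflexive old) (begin
    ∑ (n G c2) (λ y → ∑ (n G c3) λ z →
      𝟙 (adj (G′ c1) c1 (n G c1) c2 y ∧ adj (G′ c1) c1 (n G c1) c3 z ∧ adj (G′ c1) c2 y c3 z))
      ≤⟨ ∑-mono-≤ (n G c2) (λ y → ∑-mono-≤ (n G c3) (new y)) ⟩
    ∑ (n G c2) (λ y → ∑ (n G c3) λ z → 𝟙 ((y <ᵇ k₂) ∧ (z <ᵇ k₃)))
      ≡⟨ ∑∑-<ᵇ (n G c2) (n G c3) k₂ k₃ ⟩
    (n G c2 ⊓ k₂) * (n G c3 ⊓ k₃)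
      ≤⟨ *-mono-≤ (m⊓n≤n (n G c2) k₂) (m⊓n≤n (n G c3) k₃) ⟩
    k₂ * k₃ ∎)
    where
    open ≤-Reasoning
    k₂ k₃ : ℕ
    k₂ = kk Δ G c1 c2
    k₃ = kk Δ G c1 c3
    old : ∑ (n G c1) (λ x → ∑ (n G c2) λ y → ∑ (n G c3) λ z →
            𝟙 (adj (G′ c1) c1 x c2 y ∧ adj (G′ c1) c1 x c3 z ∧ adj (G′ c1) c2 y c3 z))
          ≡ triangles G
    old = ∑-cong (n G c1) λ x x<n → ∑-cong (n G c2) λ y y<n → ∑-cong (n G c3) λ z z<n →
      cong 𝟙 (cong₂ _∧_ (adj-addV-old c1 x<n y<n) (cong₂ _∧_ (adj-addV-old c1 x<n z<n) (adj-addV-old c1 y<n z<n)))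
    𝟙-∧∧-≤ : ∀ p q r → 𝟙 (p ∧ q ∧ r) ≤ 𝟙 (p ∧ q)
    𝟙-∧∧-≤ true true r = 𝟙≤1 r
    𝟙-∧∧-≤ true false r = z≤n
    𝟙-∧∧-≤ false q r = z≤n
    new : ∀ y z → 𝟙 (adj (G′ c1) c1 (n G c1) c2 y ∧ adj (G′ c1) c1 (n G c1) c3 z ∧ adj (G′ c1) c2 y c3 z)
                  ≤ 𝟙 ((y <ᵇ k₂) ∧ (z <ᵇ k₃))
    new y z = subst (λ p → 𝟙 p ≤ 𝟙 ((y <ᵇ k₂) ∧ (z <ᵇ k₃)))
      (cong₂ (λ p q → p ∧ q ∧ adj (G′ c1) c2 y c3 z) (sym (adj-addV-newˡ c1)) (sym (adj-addV-newˡ c1)))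
      (𝟙-∧∧-≤ (y <ᵇ k₂) (z <ᵇ k₃) (adj (G′ c1) c2 y c3 z))

  triangles-addV₃ : triangles (G′ c3) ≡ triangles G + edgesWithin G (kk Δ G c3 c1) (kk Δ G c3 c2)
  triangles-addV₃ = begin
    triangles (G′ c3)
      ≡⟨ ∑-cong (n G c1) (λ x x<n → ∑-cong (n G c2) λ y y<n → cong₂ _+_
           (∑-cong (n G c3) λ z z<n → cong 𝟙 (cong₂ _∧_ (adj-addV-old c3 x<n y<n)
             (cong₂ _∧_ (adj-addV-old c3 x<n z<n) (adj-addV-old c3 y<n z<n))))
           (cong 𝟙 (cong₂ _∧_ (adj-addV-old c3 x<n y<n)
             (cong₂ _∧_ (adj-addV-newʳ c3 (λ ())) (adj-addV-newʳ c3 (λ ())))))) ⟩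
    ∑ (n G c1) (λ x → ∑ (n G c2) λ y → ∑ (n G c3) (T x y) + 𝟙 (adj G c1 x c2 y ∧ (x <ᵇ k₁) ∧ (y <ᵇ k₂)))
      ≡⟨ ∑-cong (n G c1) (λ x _ → ∑-+ (n G c2) _ _) ⟩
    ∑ (n G c1) (λ x → ∑ (n G c2) (λ y → ∑ (n G c3) (T x y))
                      + ∑ (n G c2) λ y → 𝟙 (adj G c1 x c2 y ∧ (x <ᵇ k₁) ∧ (y <ᵇ k₂)))
      ≡⟨ ∑-+ (n G c1) _ _ ⟩
    triangles G + edgesWithin G k₁ k₂ ∎
    where
    open ≡-Reasoning
    k₁ k₂ : ℕ
    k₁ = kk Δ G c3 c1
    k₂ = kk Δ G c3 c2
    T : ℕ → ℕ → ℕ → ℕ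
    T x y z = 𝟙 (adj G c1 x c2 y ∧ adj G c1 x c3 z ∧ adj G c2 y c3 z)

  edgesWithin-addV₁ : ∀ K₁ K₂ →
    edgesWithin (G′ c1) K₁ K₂ ≤ (n G c1 ⊓ K₁) * K₂ + 𝟙 (n G c1 <ᵇ K₁) * kk Δ G c1 c2
  edgesWithin-addV₁ K₁ K₂ = +-mono-≤ old new
    where
    open ≤-Reasoning
    N k₂ : ℕ
    N = n G c1
    k₂ = kk Δ G c1 c2
    old : ∑ N (λ x → ∑ (n G c2) λ y → 𝟙 (adj (G′ c1) c1 x c2 y ∧ (x <ᵇ K₁) ∧ (y <ᵇ K₂))) ≤ (N ⊓ K₁) * K₂
    old = begin
      ∑ N (λ x → ∑ (n G c2) λ y → 𝟙 (adj (G′ c1) c1 x c2 y ∧ (x <ᵇ K₁) ∧ (y <ᵇ K₂)))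
        ≤⟨ ∑-mono-≤ N (λ x → ∑-mono-≤ (n G c2) λ y → 𝟙-∧-≤ʳ (adj (G′ c1) c1 x c2 y) ((x <ᵇ K₁) ∧ (y <ᵇ K₂))) ⟩
      ∑ N (λ x → ∑ (n G c2) λ y → 𝟙 ((x <ᵇ K₁) ∧ (y <ᵇ K₂)))
        ≡⟨ ∑∑-<ᵇ N (n G c2) K₁ K₂ ⟩
      (N ⊓ K₁) * (n G c2 ⊓ K₂)
        ≤⟨ *-monoʳ-≤ (N ⊓ K₁) (m⊓n≤n (n G c2) K₂) ⟩
      (N ⊓ K₁) * K₂ ∎
    𝟙-∧∧-≤-* : ∀ p d q → 𝟙 (p ∧ d ∧ q) ≤ 𝟙 d * 𝟙 p
    𝟙-∧∧-≤-* true true q = 𝟙≤1 q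
    𝟙-∧∧-≤-* true false q = z≤n
    𝟙-∧∧-≤-* false d q = z≤n
    new-vertex : ∀ y → 𝟙 (adj (G′ c1) c1 N c2 y ∧ (N <ᵇ K₁) ∧ (y <ᵇ K₂)) ≤ 𝟙 (N <ᵇ K₁) * 𝟙 (y <ᵇ k₂)
    new-vertex y = subst (λ p → 𝟙 (p ∧ (N <ᵇ K₁) ∧ (y <ᵇ K₂)) ≤ 𝟙 (N <ᵇ K₁) * 𝟙 (y <ᵇ k₂))
      (sym (adj-addV-newˡ c1)) (𝟙-∧∧-≤-* (y <ᵇ k₂) (N <ᵇ K₁) (y <ᵇ K₂))
    new : ∑ (n G c2) (λ y → 𝟙 (adj (G′ c1) c1 N c2 y ∧ (N <ᵇ K₁) ∧ (y <ᵇ K₂))) ≤ 𝟙 (N <ᵇ K₁) * k₂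
    new = begin
      ∑ (n G c2) (λ y → 𝟙 (adj (G′ c1) c1 N c2 y ∧ (N <ᵇ K₁) ∧ (y <ᵇ K₂)))
        ≤⟨ ∑-mono-≤ (n G c2) new-vertex ⟩
      ∑ (n G c2) (λ y → 𝟙 (N <ᵇ K₁) * 𝟙 (y <ᵇ k₂))
        ≡⟨ ∑-*ˡ (n G c2) (𝟙 (N <ᵇ K₁)) _ ⟩
      𝟙 (N <ᵇ K₁) * ∑ (n G c2) (λ y → 𝟙 (y <ᵇ k₂))
        ≡⟨ cong (𝟙 (N <ᵇ K₁) *_) (∑-<ᵇ-≤ (kk≤n Δ G c1 c2)) ⟩
      𝟙 (N <ᵇ K₁) * k₂ ∎

-- The graphs of the construction

edges-G₀ : ∀ P a b → edges (G₀ P) a b ≡ g P a * g P b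
edges-G₀ P a b =
  trans (∑-cong (g P a) λ _ _ → trans (∑-const (g P b) 1) (*-identityʳ (g P b))) (∑-const (g P a) (g P b))

triangles-G₀ : ∀ P → triangles (G₀ P) ≡ g P c1 * (g P c2 * g P c3)
triangles-G₀ P =
  trans (∑-cong (g P c1) λ _ _ → trans (∑-cong (g P c2) λ _ _ → trans (∑-const (g P c3) 1) (*-identityʳ (g P c3)))
                                       (∑-const (g P c2) (g P c3)))
        (∑-const (g P c1) (g P c2 * g P c3))

-- The counts of the complete 3-partite graph on g₁, g₂, g₃ vertices with a colour-1 vertex
-- added (a₂, a₃ neighbours of colours 2, 3) and a colour-3 vertex added (k neighbours of colour 2,
-- m old ones of colour 1, and d ≤ 1 for the new colour-1 vertex); absent vertices have no neighbours.
record Profile (g₁ g₂ g₃ : ℕ) (G : Graph) : Set where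
  field
    a₂ a₃ m d k : ℕ
    m≤g₁ : m ≤ g₁
    a₂≤g₂ : a₂ ≤ g₂
    k≤g₂ : k ≤ g₂
    edges₁₂ : edges G c1 c2 ≡ g₁ * g₂ + a₂
    edges₁₃ : edges G c1 c3 ≡ g₁ * g₃ + a₃ + (m + d)
    edges₂₃ : edges G c2 c3 ≡ g₂ * g₃ + k
    triangles≤ : triangles G ≤ g₁ * (g₂ * g₃) + a₂ * a₃ + m * k + d * a₂

-- With g₁ = m + x and g₂ = a₂ + u the right side exceeds the left by x k u + a₂ m (g₂ − k).
profile-inequality : ∀ g₁ g₂ g₃ a₂ a₃ m d k → m ≤ g₁ → a₂ ≤ g₂ → k ≤ g₂ →
  g₂ * (g₁ * (g₂ * g₃) + a₂ * a₃ + m * k + d * a₂) + a₂ * (g₁ * (g₂ * g₃ + k))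
    ≤ g₂ * (g₁ * (g₂ * g₃ + k)) + a₂ * (g₂ * (g₁ * g₃ + a₃ + (m + d)))
profile-inequality g₁ g₂ g₃ a₂ a₃ m d k m≤g₁ a₂≤g₂ k≤g₂
  with x , refl ← m≤n⇒∃[o]m+o≡n m≤g₁ | u , refl ← m≤n⇒∃[o]m+o≡n a₂≤g₂ =
  +-cancelʳ-≤ (a₂ * m * (a₂ + u)) _ _ (begin
    lhs + a₂ * m * (a₂ + u)                 ≤⟨ +-monoʳ-≤ lhs (m≤n+m _ (x * k * u)) ⟩
    lhs + (x * k * u + a₂ * m * (a₂ + u))   ≡⟨ slack g₃ a₂ a₃ m d k x u ⟩
    rhs + a₂ * m * k                        ≤⟨ +-monoʳ-≤ rhs (*-monoʳ-≤ (a₂ * m) k≤g₂) ⟩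
    rhs + a₂ * m * (a₂ + u)                 ∎)
  where
  open ≤-Reasoning
  lhs rhs : ℕ
  lhs = (a₂ + u) * ((m + x) * ((a₂ + u) * g₃) + a₂ * a₃ + m * k + d * a₂) + a₂ * ((m + x) * ((a₂ + u) * g₃ + k))
  rhs = (a₂ + u) * ((m + x) * ((a₂ + u) * g₃ + k)) + a₂ * ((a₂ + u) * ((m + x) * g₃ + a₃ + (m + d)))
  slack : ∀ g₃ a₂ a₃ m d k x u →
    (a₂ + u) * ((m + x) * ((a₂ + u) * g₃) + a₂ * a₃ + m * k + d * a₂) + a₂ * ((m + x) * ((a₂ + u) * g₃ + k))
      + (x * k * u + a₂ * m * (a₂ + u))
    ≡ (a₂ + u) * ((m + x) * ((a₂ + u) * g₃ + k)) + a₂ * ((a₂ + u) * ((m + x) * g₃ + a₃ + (m + d))) + a₂ * m * k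
  slack = solve-∀

profile-≤-vForm : ∀ {g₁ g₂ g₃ G} .{{_ : NonZero g₂}} (π : Profile g₁ g₂ g₃ G) →
  ℕ→ℚ (triangles G) ℚ.≤ vForm (g₁ * edges G c2 c3) (Profile.a₂ π) (edges G c1 c3) g₂
profile-≤-vForm {g₁} {g₂} {g₃} {G} π rewrite Profile.edges₂₃ π | Profile.edges₁₃ π =
  ≤-vForm (triangles G) (g₁ * (g₂ * g₃ + k)) a₂ (g₁ * g₃ + a₃ + (m + d)) g₂ (≤-trans
    (+-monoˡ-≤ (a₂ * (g₁ * (g₂ * g₃ + k))) (*-monoʳ-≤ g₂ triangles≤))
    (profile-inequality g₁ g₂ g₃ a₂ a₃ m d k m≤g₁ a₂≤g₂ k≤g₂))
  where open Profile π

r≡2⇒colours : ∀ a b → a ≢ b → 6 ∸ colNum a ∸ colNum b ≡ 2 → (a ≡ c1 × b ≡ c3) ⊎ (a ≡ c3 × b ≡ c1)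
r≡2⇒colours zero (suc (suc zero)) _ _ = inj₁ (refl , refl)
r≡2⇒colours (suc (suc zero)) zero _ _ = inj₂ (refl , refl)
r≡2⇒colours (suc zero) (suc zero) a≢b _ = ⊥-elim (a≢b refl)
r≡2⇒colours zero zero _ ()
r≡2⇒colours zero (suc zero) _ ()
r≡2⇒colours (suc zero) zero _ ()
r≡2⇒colours (suc zero) (suc (suc zero)) _ ()
r≡2⇒colours (suc (suc zero)) (suc zero) _ ()
r≡2⇒colours (suc (suc zero)) (suc (suc zero)) _ ()

module _ (Δ : Pre) (P : Params) where

  private
    g₁ g₂ g₃ : ℕ
    g₁ = g P c1
    g₂ = g P c2
    g₃ = g P c3

    G₀′ G₀₁ G₀₃ : Graph
    G₀′ = G₀ P
    G₀₁ = addV Δ G₀′ c1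
    G₀₃ = addV Δ G₀′ c3

  profile-G₀ : Profile g₁ g₂ g₃ G₀′
  profile-G₀ = record
    { a₂ = 0 ; a₃ = 0 ; m = 0 ; d = 0 ; k = 0
    ; m≤g₁ = z≤n ; a₂≤g₂ = z≤n ; k≤g₂ = z≤n
    ; edges₁₂ = trans (edges-G₀ P c1 c2) (sym (+-identityʳ _))
    ; edges₁₃ = trans (edges-G₀ P c1 c3) (sym (trans (+-identityʳ _) (+-identityʳ _)))
    ; edges₂₃ = trans (edges-G₀ P c2 c3) (sym (+-identityʳ _))
    ; triangles≤ = ≤-reflexive
        (trans (triangles-G₀ P) (sym (trans (+-identityʳ _) (trans (+-identityʳ _) (+-identityʳ _)))))
    }


  profile-G₀₁ : Profile g₁ g₂ g₃ G₀₁
  profile-G₀₁ = record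
    { a₂ = k₂ ; a₃ = k₃ ; m = 0 ; d = 0 ; k = 0
    ; m≤g₁ = z≤n ; a₂≤g₂ = kk≤n Δ G₀′ c1 c2 ; k≤g₂ = z≤n
    ; edges₁₂ = trans (edges-addV-from Δ G₀′ c1 c2 (λ ())) (cong (_+ k₂) (edges-G₀ P c1 c2))
    ; edges₁₃ = trans (edges-addV-from Δ G₀′ c1 c3 (λ ())) (trans (cong (_+ k₃) (edges-G₀ P c1 c3)) (sym (+-identityʳ _)))
    ; edges₂₃ = trans (edges-addV-apart Δ G₀′ c1 c2 c3 (λ ()) (λ ())) (trans (edges-G₀ P c2 c3) (sym (+-identityʳ _)))
    ; triangles≤ = ≤-trans (triangles-addV₁ Δ G₀′)
        (≤-reflexive (trans (cong (_+ k₂ * k₃) (triangles-G₀ P)) (sym (trans (+-identityʳ _) (+-identityʳ _)))))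
    }
    where
    k₂ k₃ : ℕ
    k₂ = kk Δ G₀′ c1 c2
    k₃ = kk Δ G₀′ c1 c3

  profile-G₀₃ : Profile g₁ g₂ g₃ G₀₃
  profile-G₀₃ = record
    { a₂ = 0 ; a₃ = 0 ; m = k₁ ; d = 0 ; k = k₂
    ; m≤g₁ = kk≤n Δ G₀′ c3 c1 ; a₂≤g₂ = z≤n ; k≤g₂ = kk≤n Δ G₀′ c3 c2
    ; edges₁₂ = trans (edges-addV-apart Δ G₀′ c3 c1 c2 (λ ()) (λ ())) (trans (edges-G₀ P c1 c2) (sym (+-identityʳ _)))
    ; edges₁₃ = trans (edges-addV-to Δ G₀′ c3 c1 (λ ()))
        (trans (cong (_+ k₁) (edges-G₀ P c1 c3)) (sym (cong₂ _+_ (+-identityʳ _) (+-identityʳ k₁))))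
    ; edges₂₃ = trans (edges-addV-to Δ G₀′ c3 c2 (λ ())) (cong (_+ k₂) (edges-G₀ P c2 c3))
    ; triangles≤ = ≤-trans (≤-reflexive (triangles-addV₃ Δ G₀′))
        (≤-trans (+-mono-≤ (≤-reflexive (triangles-G₀ P)) (edgesWithin-≤ G₀′ k₁ k₂))
          (≤-trans (+-monoʳ-≤ (g₁ * (g₂ * g₃)) (*-mono-≤ (m⊓n≤n g₁ k₁) (m⊓n≤n g₂ k₂)))
            (≤-reflexive (trans (sym (+-identityʳ _)) (cong (λ e → e + k₁ * k₂ + 0) (sym (+-identityʳ _)))))))
    }
    where
    k₁ k₂ : ℕ
    k₁ = kk Δ G₀′ c3 c1
    k₂ = kk Δ G₀′ c3 c2

  profile-G₀₁₃ : Profile g₁ g₂ g₃ (addV Δ G₀₁ c3)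
  profile-G₀₁₃ = record
    { a₂ = k₂ ; a₃ = k₃ ; m = g₁ ⊓ Q₁ ; d = 𝟙 (g₁ <ᵇ Q₁) ; k = Q₂
    ; m≤g₁ = m⊓n≤m g₁ Q₁ ; a₂≤g₂ = kk≤n Δ G₀′ c1 c2 ; k≤g₂ = kk≤n Δ G₀₁ c3 c2
    ; edges₁₂ = trans (edges-addV-apart Δ G₀₁ c3 c1 c2 (λ ()) (λ ())) (Profile.edges₁₂ profile-G₀₁)
    ; edges₁₃ = trans (edges-addV-to Δ G₀₁ c3 c1 (λ ()))
        (trans (cong (_+ Q₁) (edges-addV-from Δ G₀′ c1 c3 (λ ())))
          (trans (cong (λ e → e + k₃ + Q₁) (edges-G₀ P c1 c3))
            (cong (g₁ * g₃ + k₃ +_) (⊓-+-𝟙<ᵇ g₁ (kk≤n Δ G₀₁ c3 c1)))))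
    ; edges₂₃ = trans (edges-addV-to Δ G₀₁ c3 c2 (λ ()))
        (cong (_+ Q₂) (trans (edges-addV-apart Δ G₀′ c1 c2 c3 (λ ()) (λ ())) (edges-G₀ P c2 c3)))
    ; triangles≤ = ≤-trans (≤-reflexive (triangles-addV₃ Δ G₀₁))
        (≤-trans (+-mono-≤ (Profile.triangles≤ profile-G₀₁) (edgesWithin-addV₁ Δ G₀′ Q₁ Q₂))
          (≤-reflexive (regroup (g₁ * (g₂ * g₃)) (k₂ * k₃) ((g₁ ⊓ Q₁) * Q₂) (𝟙 (g₁ <ᵇ Q₁) * k₂))))
    }
    where
    k₂ k₃ Q₁ Q₂ : ℕ
    k₂ = kk Δ G₀′ c1 c2
    k₃ = kk Δ G₀′ c1 c3
    Q₁ = kk Δ G₀₁ c3 c1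
    Q₂ = kk Δ G₀₁ c3 c2
    regroup : ∀ w x y z → w + x + 0 + 0 + (y + z) ≡ w + x + y + z
    regroup = solve-∀

  profile-G₀₃₁ : Profile g₁ g₂ g₃ (addV Δ G₀₃ c1)
  profile-G₀₃₁ = record
    { a₂ = A₂ ; a₃ = A₃ ; m = k₁ ; d = 0 ; k = k₂
    ; m≤g₁ = kk≤n Δ G₀′ c3 c1 ; a₂≤g₂ = kk≤n Δ G₀₃ c1 c2 ; k≤g₂ = kk≤n Δ G₀′ c3 c2
    ; edges₁₂ = trans (edges-addV-from Δ G₀₃ c1 c2 (λ ()))
        (cong (_+ A₂) (trans (edges-addV-apart Δ G₀′ c3 c1 c2 (λ ()) (λ ())) (edges-G₀ P c1 c2)))
    ; edges₁₃ = trans (edges-addV-from Δ G₀₃ c1 c3 (λ ()))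
        (trans (cong (_+ A₃) (trans (edges-addV-to Δ G₀′ c3 c1 (λ ())) (cong (_+ k₁) (edges-G₀ P c1 c3))))
          (swap (g₁ * g₃) k₁ A₃))
    ; edges₂₃ = trans (edges-addV-apart Δ G₀₃ c1 c2 c3 (λ ()) (λ ())) (Profile.edges₂₃ profile-G₀₃)
    ; triangles≤ = ≤-trans (triangles-addV₁ Δ G₀₃)
        (≤-trans (+-monoˡ-≤ (A₂ * A₃) (Profile.triangles≤ profile-G₀₃))
          (≤-reflexive (regroup (g₁ * (g₂ * g₃)) (k₁ * k₂) (A₂ * A₃))))
    }
    where
    k₁ k₂ A₂ A₃ : ℕ
    k₁ = kk Δ G₀′ c3 c1
    k₂ = kk Δ G₀′ c3 c2
    A₂ = kk Δ G₀₃ c1 c2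
    A₃ = kk Δ G₀₃ c1 c3
    swap : ∀ x y z → x + y + z ≡ x + z + (y + 0)
    swap = solve-∀
    regroup : ∀ x y z → x + 0 + y + 0 + z ≡ x + z + y + 0
    regroup = solve-∀

  step-cases : (Q : Graph → Set) {G : Graph} (col : Fin 3) → Q G → Q (addV Δ G col) → Q (step Δ P G col)
  step-cases Q col qG qA with g P col <ᵇ fV col Δ
  ... | true = qA
  ... | false = qG

  profile-Γ : r P ≡ 2 → Profile g₁ g₂ g₃ (Γ Δ P)
  profile-Γ r≡2 with r≡2⇒colours (p P) (q P) (p≢q P) r≡2
  ... | inj₁ (p≡c1 , q≡c3) rewrite p≡c1 | q≡c3 =
    step-cases (λ G → Profile g₁ g₂ g₃ (step Δ P G c3)) c1
      (step-cases (Profile g₁ g₂ g₃) c3 profile-G₀ profile-G₀₃)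
      (step-cases (Profile g₁ g₂ g₃) c3 profile-G₀₁ profile-G₀₁₃)
  ... | inj₂ (p≡c3 , q≡c1) rewrite p≡c3 | q≡c1 =
    step-cases (λ G → Profile g₁ g₂ g₃ (step Δ P G c1)) c3
      (step-cases (Profile g₁ g₂ g₃) c1 profile-G₀ profile-G₀₁)
      (step-cases (Profile g₁ g₂ g₃) c1 profile-G₀₃ profile-G₀₃₁)

m≤n⇒o≤p⇒m+o≡n+p⇒m≡n : ∀ {m n o p} → m ≤ n → o ≤ p → m + o ≡ n + p → m ≡ n
m≤n⇒o≤p⇒m+o≡n+p⇒m≡n {m} {n} {o} {p} m≤n o≤p m+o≡n+p =
  ≤-antisym m≤n (+-cancelʳ-≤ o n m (≤-trans (+-monoʳ-≤ n o≤p) (≤-reflexive (sym m+o≡n+p))))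

summands-≡ : ∀ {a b c a′ b′ c′} → a ≤ a′ → b ≤ b′ → c ≤ c′ → a + b + c ≡ a′ + b′ + c′ →
             a ≡ a′ × b ≡ b′ × c ≡ c′
summands-≡ {a} {b} {c} {a′} {b′} {c′} a≤a′ b≤b′ c≤c′ sum≡ =
    m≤n⇒o≤p⇒m+o≡n+p⇒m≡n a≤a′ (+-mono-≤ b≤b′ c≤c′)
      (trans (sym (+-assoc a b c)) (trans sum≡ (+-assoc a′ b′ c′)))
  , m≤n⇒o≤p⇒m+o≡n+p⇒m≡n b≤b′ (+-mono-≤ a≤a′ c≤c′)
      (trans (middle a b c) (trans sum≡ (sym (middle a′ b′ c′))))
  , m≤n⇒o≤p⇒m+o≡n+p⇒m≡n c≤c′ (+-mono-≤ a≤a′ b≤b′)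
      (trans (sym (+-comm (a + b) c)) (trans sum≡ (+-comm (a′ + b′) c′)))
  where
  middle : ∀ x y z → y + (x + z) ≡ x + y + z
  middle = solve-∀

Γ-edges : ∀ Δ P → let G = Γ (pre Δ) P in
  InA Δ P → edgeSum (flag G) ≡ edgeSum (pre Δ) →
  edges G c1 c2 ≡ fE c1 c2 (pre Δ) × edges G c1 c3 ≡ fE c1 c3 (pre Δ) × edges G c2 c3 ≡ fE c2 c3 (pre Δ)
Γ-edges Δ P (_ , f≤) edgeSum≡ =
    trans (sym (f12-flag G)) (proj₁ equal)
  , trans (sym (f13-flag G)) (proj₁ (proj₂ equal))
  , trans (sym (f23-flag G)) (proj₂ (proj₂ equal))
  where
  G : Graph
  G = Γ (pre Δ) P
  equal : fE c1 c2 (flag G) ≡ fE c1 c2 (pre Δ)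
        × fE c1 c3 (flag G) ≡ fE c1 c3 (pre Δ)
        × fE c2 c3 (flag G) ≡ fE c2 c3 (pre Δ)
  equal = summands-≡ (f≤ (pairS c1 c2) (λ ())) (f≤ (pairS c1 c3) (λ ())) (f≤ (pairS c2 c3) (λ ())) edgeSum≡

lemma2p19 : (Δ : Complex3) (Γp : Params) → InF Δ Γp → g Γp c1 ≡ b₁ (pre Δ) → r Γp ≡ 2 →
    ℚ._≤_ (ℕ→ℚ (f123 (flag (Γ (pre Δ) Γp)))) (v (pre Δ) (g Γp c2) {{g-pos Γp c2}})
lemma2p19 Δ P (inA , edgeSum≡ , _ , _) g₁≡b₁ r≡2 = begin
  ℕ→ℚ (f123 (flag G))                                ≡⟨ cong ℕ→ℚ (f123-flag G) ⟩
  ℕ→ℚ (triangles G)                                  ≤⟨ profile-≤-vForm π ⟩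
  vForm (g₁ * edges G c2 c3) a₂ (edges G c1 c3) g₂   ≡⟨ cong₂ (λ A E → vForm A a₂ E g₂) (cong₂ _*_ g₁≡b₁ e₂₃) e₁₃ ⟩
  vForm (b₁ D * fE c2 c3 D) a₂ (fE c1 c3 D) g₂       ≡⟨ v≡vForm D g₂ a₂ f₁₂≡ ⟨
  v D g₂                                             ∎
  where
  open ℚP.≤-Reasoning
  D : Pre
  D = pre Δ
  G : Graph
  G = Γ D P
  g₁ g₂ : ℕ
  g₁ = g P c1
  g₂ = g P c2
  instance
    g₂-nonZero : NonZero g₂
    g₂-nonZero = g-pos P c2
  π : Profile g₁ g₂ (g P c3) G
  π = profile-Γ D P r≡2
  a₂ : ℕ
  a₂ = Profile.a₂ π
  e₁₂ : edges G c1 c2 ≡ fE c1 c2 D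
  e₁₂ = proj₁ (Γ-edges Δ P inA edgeSum≡)
  e₁₃ : edges G c1 c3 ≡ fE c1 c3 D
  e₁₃ = proj₁ (proj₂ (Γ-edges Δ P inA edgeSum≡))
  e₂₃ : edges G c2 c3 ≡ fE c2 c3 D
  e₂₃ = proj₂ (proj₂ (Γ-edges Δ P inA edgeSum≡))
  f₁₂≡ : fE c1 c2 D ≡ b₁ D * g₂ + a₂
  f₁₂≡ = trans (sym e₁₂) (trans (Profile.edges₁₂ π) (cong (λ b → b * g₂ + a₂) g₁≡b₁))
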